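{- Let $\mathcal{G}=(H,\sigma,\alpha,h_0)$ be a rooted combinatorial map with underlying graph $G=(V,E)$, let $T_0$ be a spanning tree and let $S$ be a subgraph in the tree-interval $[T_0^-,T_0^+]$. Then the procedure $\Delta$ below, run on $S$, terminates and returns $T_0$. Procedure $\Delta$ on input $S\subseteq E$: initialize the current half-edge $h:=h_0$, $T:=\emptyset$, $F:=\emptyset$. Repeat: (C1) let $e$ be the edge containing $h$; if $e\notin F$, add $e$ to $T$ if either ($e\in S$ and $e$ belongs to no cycle $C\subseteq S\cap(E\setminus F)$) or ($e\notin S$ and $e$ belongs to some cocycle $D\subseteq (E\setminus S)\cap(E\setminus F)$); then add $e$ to $F$. (C2) If $e\in T$ set $h:=\sigma\alpha(h)$, else set $h:=\sigma(h)$. Stop when $h=h_0$ again and return $T$.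
   Context: A rooted combinatorial map is $\mathcal{G}=(H,\sigma,\alpha,h_0)$ where $H$ is a finite set of half-edges, $\sigma$ a permutation of $H$, $\alpha$ a fixed-point-free involution of $H$, the group generated by $\sigma,\alpha$ acts transitively on $H$, and $h_0\in H$ is the root. Its underlying graph $G=(V,E)$ has the cycles of $\sigma$ as vertices and the pairs $\{h,\alpha(h)\}$ as edges, with endpoints the vertices containing the two half-edges (loops, multiple edges allowed). Subgraphs are spanning and identified with edge sets. A cycle is the edge set of a simple closed path; a cocycle is a minimal (for inclusion) set of edges whose deletion increases the number of connected components. For a spanning tree $T$, edges in $T$ are internal, others external; the motion function is $t(h)=\sigma\alpha(h)$ if the edge of $h$ is internal, $t(h)=\sigma(h)$ otherwise (a cyclic permutation of $H$); the $(\mathcal{G},T)$-order on $H$ is $h_0<t(h_0)<\dots<t^{|H|-1}(h_0)$, and edges are compared via their smaller half-edge. The fundamental cycle of an external edge $e$ is the set of $e'$ with $T-e'+e$ a spanning tree; the fundamental cocycle of an internal edge $e$ is the set of $e'$ with $T-e+e'$ a spanning tree. An edge is $(\mathcal{G},T)$-active if it is minimal for the $(\mathcal{G},T)$-order in its fundamental cycle (external) or fundamental cocycle (internal). The tree-interval $[T^-,T^+]$ is the set of subgraphs obtained from $T$ by removing some internal $(\mathcal{G},T)$-active edges and adding some external $(\mathcal{G},T)$-active edges. -}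

module Defs where

open import Data.Nat using (ℕ; zero; suc; _<_)
open import Data.Fin using (Fin; zero; suc; fromℕ; inject₁)
open import Data.Fin.Subset using (Subset; _∈_; _∉_; _⊆_; _∪_; _∩_; ∁; ⁅_⁆; ⊥)
open import Data.Fin.Permutation using (Permutation′; _⟨$⟩ʳ_; _⟨$⟩ˡ_)
open import Data.Product using (Σ; ∃; _×_; _,_)
open import Data.Sum using (_⊎_)
open import Relation.Nullary using (¬_; yes; no)
open import Data.Fin.Subset.Properties using (_∈?_)
open import Relation.Binary.PropositionalEquality using (_≡_; _≢_)
open import Relation.Binary.Construct.Closure.ReflexiveTransitive using (Star)

iter : ∀ {A : Set} → (A → A) → ℕ → A → A
iter f zero    x = x
iter f (suc k) x = f (iter f k x)

record RootedMap : Set where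
  field
    n     : ℕ
    σ     : Permutation′ n
    α     : Fin n → Fin n
    α-inv : ∀ h → α (α h) ≡ h
    α-fpf : ∀ h → α h ≢ h
    -- the group generated by σ and α acts transitively on H
    trans : ∀ h h' → Star (λ x y → (y ≡ σ ⟨$⟩ʳ x) ⊎ (y ≡ σ ⟨$⟩ˡ x) ⊎ (y ≡ α x)) h h'
    root  : Fin n

module _ (M : RootedMap) where
  open RootedMap M

  H : Set
  H = Fin n

  σf : H → H
  σf h = σ ⟨$⟩ʳ h

  -- Edge sets (subgraphs) are represented as subsets of half-edges that
  -- are closed under α: an edge {h, α h} belongs to S iff h ∈ S.
  EdgeSet : Set
  EdgeSet = Subset n

  Closed : EdgeSet → Set
  Closed S = ∀ h → h ∈ S → α h ∈ S

  edgeOf : H → EdgeSet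
  edgeOf h = ⁅ h ⁆ ∪ ⁅ α h ⁆

  -- two half-edges lie in the same vertex (same cycle of σ)
  SameVertex : H → H → Set
  SameVertex h h' = ∃ λ k → iter σf k h ≡ h'

  Adj : EdgeSet → H → H → Set
  Adj A h h' = SameVertex h h' ⊎ (h ∈ A × h' ≡ α h)

  Connected : EdgeSet → Set
  Connected A = ∀ h h' → Star (Adj A) h h'

  -- C is a cycle: the edge set of a simple closed path.
  -- The path is given by half-edges hs 0 .. hs m, the i-th edge being
  -- {hs i, α (hs i)} traversed from the vertex of hs i to that of α (hs i).
  IsCycle : EdgeSet → Set
  IsCycle C = Σ ℕ λ m → Σ (Fin (suc m) → H) λ hs →
      (∀ (i : Fin m) → SameVertex (α (hs (inject₁ i))) (hs (suc i)))
    × SameVertex (α (hs (fromℕ m))) (hs zero)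
    × (∀ i j → i ≢ j → ¬ SameVertex (hs i) (hs j))
    × (∀ i j → i ≢ j → (hs i ≢ hs j) × (hs i ≢ α (hs j)))
    × (∀ h → (h ∈ C → ∃ λ i → (h ≡ hs i) ⊎ (h ≡ α (hs i)))
           × ((∃ λ i → (h ≡ hs i) ⊎ (h ≡ α (hs i))) → h ∈ C))

  -- D is a cocycle: a minimal set of edges whose deletion increases the
  -- number of connected components (G is connected, so: disconnects G).
  IsCocycle : EdgeSet → Set
  IsCocycle D = Closed D × ¬ Connected (∁ D)
              × (∀ D' → Closed D' → D' ⊆ D → D' ≢ D → Connected (∁ D'))

  SpanningTree : EdgeSet → Set
  SpanningTree T = Closed T × Connected T × (∀ C → IsCycle C → ¬ (C ⊆ T))

  motion : EdgeSet → H → H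
  motion T h with h ∈? T
  ... | yes _ = σf (α h)
  ... | no _ = σf h

  _<[_]_ : H → EdgeSet → H → Set
  h <[ T ] h' = Σ ℕ λ i → Σ ℕ λ j → i < j × j < n
              × iter (motion T) i root ≡ h × iter (motion T) j root ≡ h'

  -- e (containing h) is minimal, w.r.t. the (G,T)-order on edges (an edge
  -- being compared through its smaller half-edge), among the edges e'
  -- satisfying P; i.e. some half-edge of e is below both half-edges of any
  -- other such e'.
  MinimalAmong : EdgeSet → H → (H → Set) → Set
  MinimalAmong T h P = Σ H λ hm → hm ∈ edgeOf h ×
    (∀ h' → P h' → h' ∉ edgeOf h → hm <[ T ] h')

  Active : EdgeSet → H → Set
  Active T h with h ∈? T
  ... | yes _ =
        MinimalAmong T h (λ h' → SpanningTree ((T ∩ ∁ (edgeOf h)) ∪ edgeOf h'))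
  ... | no _ =
        MinimalAmong T h (λ h' → SpanningTree ((T ∪ edgeOf h) ∩ ∁ (edgeOf h')))

  -- S ∈ [T⁻, T⁺]: S = T minus some internal active edges plus some
  -- external active edges.
  InTreeInterval : EdgeSet → EdgeSet → Set
  InTreeInterval T S = Closed S
    × (∀ h → h ∈ T → h ∉ S → Active T h)
    × (∀ h → h ∉ T → h ∈ S → Active T h)

  record State : Set where
    constructor ⟨_,_,_⟩
    field
      cur : H
      Tc  : EdgeSet
      Fc  : EdgeSet

  AddCond : EdgeSet → EdgeSet → H → Set
  AddCond S F h =
      (h ∈ S × ¬ (Σ EdgeSet λ C → IsCycle C × C ⊆ (S ∩ ∁ F) × h ∈ C))
    ⊎ (h ∉ S × (Σ EdgeSet λ D → IsCocycle D × D ⊆ (∁ S ∩ ∁ F) × h ∈ D))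

  next : EdgeSet → H → H
  next T h = motion T h

  data Step (S : EdgeSet) : State → State → Set where
    inF   : ∀ {h T F} → h ∈ F → Step S ⟨ h , T , F ⟩ ⟨ next T h , T , F ⟩
    add   : ∀ {h T F} → h ∉ F → AddCond S F h →
            Step S ⟨ h , T , F ⟩ ⟨ next (T ∪ edgeOf h) h , T ∪ edgeOf h , F ∪ edgeOf h ⟩
    noAdd : ∀ {h T F} → h ∉ F → ¬ AddCond S F h →
            Step S ⟨ h , T , F ⟩ ⟨ next T h , T , F ∪ edgeOf h ⟩

  -- Run S s T: starting from state s, the loop performs at least one
  -- iteration, stops as soon as the current half-edge is the root again,
  -- and returns T.
  data Run (S : EdgeSet) : State → EdgeSet → Set where
    stop : ∀ {s h T F} → Step S s ⟨ h , T , F ⟩ → h ≡ root → Run S s T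
    go   : ∀ {s h T F R} → Step S s ⟨ h , T , F ⟩ → h ≢ root →
           Run S ⟨ h , T , F ⟩ R → Run S s R

  initial : State
  initial = ⟨ root , ⊥ , ⊥ ⟩

{-# OPTIONS --safe #-}
-- Let t be the motion function of T₀ and τ k = tᵏ h₀. As T₀ is a spanning tree, t is a cyclic
-- permutation of H (after a tree half-edge h the tour returns through α h), so τ 0, …, τ (n-1)
-- lists every half-edge once and τ n = h₀. By induction on k, after k iterations Δ is at τ k,
-- its F is the set of edges met by τ 0, …, τ (k-1), and its T is T₀ ∩ F. The induction step
-- rests on one claim: when Δ meets the edge e of h for the first time, its condition for adding
-- e holds iff e ∈ T₀; then Δ also moves by t.
--
-- Activity enters only through this: the minimal half-edge of an active edge precedes in the
-- tour, hence is met before, every other edge of its fundamental cycle or cocycle. If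
-- e ∈ T₀ ∩ S, a cycle of S through e crosses the fundamental cut of e in an edge of S ∖ T₀,
-- which is active and so already in F. If e ∈ T₀ ∖ S, its fundamental cocycle avoids S and F;
-- if e ∈ S ∖ T₀, its fundamental cycle lies in S and avoids F. If e ∉ T₀ ∪ S, every cocycle
-- through e meets the fundamental cycle of e in an edge of T₀ ∖ S, which is already in F. The
-- claims about S hold because an active edge of T₀ ∖ S and an active edge of S ∖ T₀ are never
-- exchangeable: the minimal half-edge of each would precede that of the other.

module Submission where

open import Defs
open import Data.Product using (_×_)
open import Relation.Binary.PropositionalEquality using (_≡_)

open import Data.Bool as Bool using (Bool; true; false)
open import Data.Empty using (⊥-elim)
open import Data.Fin using (Fin; zero; suc; toℕ; fromℕ; fromℕ<; inject₁; _≟_)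
open import Data.Fin.Permutation using (_⟨$⟩ˡ_; inverseˡ)
open import Data.Fin.Properties
  using (any?; ¬∀⟶∃¬; pigeonhole; injective⇒≤; toℕ-fromℕ<; toℕ-fromℕ; toℕ<n; toℕ-inject₁;
         toℕ-injective; suc-injective; inject₁-injective; fromℕ≢inject₁)
open import Data.Fin.Subset using (Subset; _∈_; _∉_; _⊆_; _∪_; _∩_; ∁; ⁅_⁆)
open import Data.Fin.Subset.Properties
  using (_∈?_; x∈p∪q⁺; x∈p∪q⁻; x∈p∩q⁺; p∩q⊆p; p∩q⊆q; p⊆p∪q; q⊆p∪q; ∉⊥; x∈⁅x⁆;
         x∈⁅y⁆⇒x≡y; x∈∁p⇒x∉p; x∉p⇒x∈∁p; ⊆-antisym)
open import Data.Nat
  using (ℕ; zero; suc; _+_; _*_; _≤_; _<_; z≤n; s≤s; z<s; _≤′_; ≤′-refl; ≤′-step)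
open import Data.Nat.DivMod using (_%_; _/_; m≡m%n+[m/n]*n; m%n<n)
open import Data.Nat.Properties
  using (≤-refl; ≤-reflexive; ≤-trans; ≤-antisym; ≤-pred; <-irrefl; <-asym; <-trans;
         <-≤-trans; ≤-<-trans; <-cmp; _<?_; <⇒≤; <⇒≢; >⇒≢; <⇒≱; ≮⇒≥; ≤∧≮⇒≡; ≤′⇒≤; ≤⇒≤′;
         n<1+n; m<n⇒m<1+n; m<1+n⇒m<n∨m≡n; m≤n+m; m≤n⇒∃[o]m+o≡n; +-comm; +-suc; *-suc)
open import Data.Product using (∃; ∃₂; _,_; proj₁; proj₂)
open import Data.Sum as Sum using (_⊎_; inj₁; inj₂)
open import Data.Vec using (tabulate)
open import Data.Vec.Properties using (lookup∘tabulate; lookup⇒[]=; []=⇒lookup)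
open import Function.Base using (_∘_; const; id)
open import Function.Definitions using (Injective)
open import Level using (0ℓ)
open import Relation.Binary.Construct.Closure.ReflexiveTransitive
  using (Star; ε; _◅_; _◅◅_; reverse)
import Relation.Binary.Construct.Closure.ReflexiveTransitive as Star
open import Relation.Binary.Definitions using (DecidableEquality; tri<; tri≈; tri>)
open import Relation.Binary.PropositionalEquality
  using (_≢_; refl; sym; trans; cong; subst; subst₂; module ≡-Reasoning)
open import Relation.Nullary using (¬_; ¬?; yes; no; Dec; does)
open import Relation.Nullary.Decidable using (dec-true; map′; _⊎-dec_; _×-dec_; _→-dec_)
open import Relation.Unary using (Pred; Decidable)

module _ {A : Set} (f : A → A) where

  iter-+ : ∀ j k x → iter f (j + k) x ≡ iter f j (iter f k x)
  iter-+ zero    k x = refl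
  iter-+ (suc j) k x = cong f (iter-+ j k x)

  iter-sucʳ : ∀ k x → iter f k (f x) ≡ iter f (suc k) x
  iter-sucʳ zero    x = refl
  iter-sucʳ (suc k) x = cong f (iter-sucʳ k x)

  iter-periodic-* : ∀ {d x} → iter f d x ≡ x → ∀ q → iter f (q * d) x ≡ x
  iter-periodic-* periodic zero = refl
  iter-periodic-* {d} {x} periodic (suc q) =
    trans (iter-+ d (q * d) x) (trans (cong (iter f d) (iter-periodic-* periodic q)) periodic)

  iter-periodic-% : ∀ {d x} → iter f (suc d) x ≡ x → ∀ k → iter f (k % suc d) x ≡ iter f k x
  iter-periodic-% {d} {x} periodic k = begin
    iter f r x                       ≡⟨ cong (iter f r) (iter-periodic-* periodic q) ⟨
    iter f r (iter f (q * suc d) x)  ≡⟨ iter-+ r (q * suc d) x ⟨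
    iter f (r + q * suc d) x         ≡⟨ cong (λ i → iter f i x) (m≡m%n+[m/n]*n k (suc d)) ⟨
    iter f k x                       ∎
    where
    r q : ℕ
    r = k % suc d
    q = k / suc d
    open ≡-Reasoning

module _ {m : ℕ} (f : Fin m → Fin m) (f-injective : Injective _≡_ _≡_ f) where

  iter-cancelˡ : ∀ i {p} x → iter f i x ≡ iter f (i + p) x → iter f p x ≡ x
  iter-cancelˡ zero    x eq = sym eq
  iter-cancelˡ (suc i) x eq = iter-cancelˡ i x (f-injective eq)

  iter-repeat⇒period : ∀ x {i j} → i < j → iter f i x ≡ iter f j x →
                       ∃ λ d → suc d ≤ j × iter f (suc d) x ≡ x
  iter-repeat⇒period x {i} i<j eq with d , refl ← m≤n⇒∃[o]m+o≡n i<j =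
    d , s≤s (m≤n+m d i) , iter-cancelˡ i x (trans eq (cong (λ k → iter f k x) (sym (+-suc i d))))

  iter-period : ∀ x → ∃ λ d → suc d ≤ m × iter f (suc d) x ≡ x
  iter-period x with i , j , i<j , eq ← pigeonhole (n<1+n m) (λ k → iter f (toℕ k) x)
                   with d , d<j , periodic ← iter-repeat⇒period x i<j eq =
    d , ≤-trans d<j (≤-pred (toℕ<n j)) , periodic

  module CoveringOrbit (x : Fin m) (covers : ∀ y → ∃ λ k → iter f k x ≡ y) where

    m≤period : ∀ d → iter f (suc d) x ≡ x → m ≤ suc d
    m≤period d periodic = injective⇒≤ index-injective
      where
      index : Fin m → Fin (suc d)
      index y = fromℕ< (m%n<n (proj₁ (covers y)) (suc d))
      iter-index : ∀ y → iter f (toℕ (index y)) x ≡ y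
      iter-index y = trans (cong (λ k → iter f k x) (toℕ-fromℕ< (m%n<n (proj₁ (covers y)) (suc d))))
                           (trans (iter-periodic-% f periodic (proj₁ (covers y)))
                                  (proj₂ (covers y)))
      index-injective : Injective _≡_ _≡_ index
      index-injective {y} {z} eq =
        trans (sym (iter-index y)) (trans (cong (λ i → iter f (toℕ i) x) eq) (iter-index z))

    -- Opaque (here and below): only the existence statement is used, and unfolding its
    -- proof makes type checking very slow.
    opaque
      exact-period : ∃ λ d → suc d ≡ m × iter f (suc d) x ≡ x
      exact-period with d , d<m , periodic ← iter-period x =
        d , ≤-antisym d<m (m≤period d periodic) , periodic

    iter-m : iter f m x ≡ x
    iter-m with d , refl , periodic ← exact-period = periodic

    iter-injective : ∀ {i j} → i < j → j < m → iter f i x ≢ iter f j x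
    iter-injective i<j j<m eq with d , d<j , periodic ← iter-repeat⇒period x i<j eq =
      <-irrefl refl (<-≤-trans j<m (≤-trans (m≤period d periodic) d<j))

    iter-surjective : ∀ y → ∃ λ i → i < m × iter f i x ≡ y
    iter-surjective y with d , refl , periodic ← exact-period
                      with k , refl ← covers y =
      k % suc d , m%n<n k (suc d) , iter-periodic-% f periodic k

module _ {A : Set} (_≟_ : DecidableEquality A) (f : A → A) {P : A → Set} {y : A}
         (preserved : ∀ {z} → P z → z ≢ y → P (f z)) where

  iter-invariant-until : ∀ j {z} → P z → P (iter f j z) ⊎ ∃ λ i → iter f i z ≡ y
  iter-invariant-until zero    pz = inj₁ pz
  iter-invariant-until (suc j) {z} pz with iter-invariant-until j pz
  ... | inj₂ found = inj₂ found
  ... | inj₁ pj with iter f j z ≟ y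
  ...   | yes reached = inj₂ (j , reached)
  ...   | no  ≢y      = inj₁ (preserved pj ≢y)

module _ {m : ℕ} {P : Pred (Fin m) 0ℓ} (P? : Decidable P) where

  subset : Subset m
  subset = tabulate (λ x → does (P? x))

  ∈-subset⁺ : ∀ {x} → P x → x ∈ subset
  ∈-subset⁺ {x} px = lookup⇒[]= x subset (trans (lookup∘tabulate _ x) (dec-true (P? x) px))

  ∈-subset⁻ : ∀ {x} → x ∈ subset → P x
  ∈-subset⁻ {x} x∈ with P? x | trans (sym (lookup∘tabulate _ x)) ([]=⇒lookup x∈)
  ... | yes px | _ = px

⊂-witness : ∀ {m} {p q : Subset m} → p ⊆ q → p ≢ q → ∃ λ x → x ∈ q × x ∉ p
⊂-witness {m} {p} {q} p⊆q p≢q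
  with x , ¬q⇒p ← ¬∀⟶∃¬ m _ (λ x → (x ∈? q) →-dec (x ∈? p))
                          (λ q⊆p → p≢q (⊆-antisym p⊆q (q⊆p _)))
  with x ∈? q
... | yes x∈q = x , x∈q , ¬q⇒p ∘ const
... | no  x∉q = ⊥-elim (¬q⇒p (⊥-elim ∘ x∉q))

module _ (M : RootedMap) where

  open RootedMap M using (n; σ; α; α-inv; root)

  edge : Fin n → Subset n
  edge = edgeOf M

  _∼_ : Fin n → Fin n → Set
  _∼_ = SameVertex M

  Walk : Subset n → Fin n → Fin n → Set
  Walk A = Star (Adj M A)

  α-injective : Injective _≡_ _≡_ α
  α-injective {a} {b} eq = trans (sym (α-inv a)) (trans (cong α eq) (α-inv b))

  σ-injective : Injective _≡_ _≡_ (σf M)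
  σ-injective eq = trans (sym (inverseˡ σ)) (trans (cong (σ ⟨$⟩ˡ_) eq) (inverseˡ σ))

  h∈edge : ∀ h → h ∈ edge h
  h∈edge h = x∈p∪q⁺ (inj₁ (x∈⁅x⁆ h))

  αh∈edge : ∀ h → α h ∈ edge h
  αh∈edge h = x∈p∪q⁺ (inj₂ (x∈⁅x⁆ (α h)))

  ∈-edge⁻ : ∀ {g h} → g ∈ edge h → g ≡ h ⊎ g ≡ α h
  ∈-edge⁻ {h = h} g∈ =
    Sum.map (x∈⁅y⁆⇒x≡y h) (x∈⁅y⁆⇒x≡y (α h)) (x∈p∪q⁻ ⁅ h ⁆ ⁅ α h ⁆ g∈)

  ∈-edge-sym : ∀ {g h} → g ∈ edge h → h ∈ edge g
  ∈-edge-sym {h = h} g∈ with ∈-edge⁻ g∈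
  ... | inj₁ refl = h∈edge h
  ... | inj₂ refl = subst (_∈ edge (α h)) (α-inv h) (αh∈edge (α h))

  edge⊆ : ∀ {A} → Closed M A → ∀ {h} → h ∈ A → edge h ⊆ A
  edge⊆ closed h∈A g∈ with ∈-edge⁻ g∈
  ... | inj₁ refl = h∈A
  ... | inj₂ refl = closed _ h∈A

  edge-closed : ∀ h → Closed M (edge h)
  edge-closed h g g∈ with ∈-edge⁻ g∈
  ... | inj₁ refl = αh∈edge h
  ... | inj₂ refl = subst (_∈ edge h) (sym (α-inv h)) (h∈edge h)

  edge-≡ : ∀ {g h} → g ∈ edge h → edge g ≡ edge h
  edge-≡ {g} {h} g∈ =
    ⊆-antisym (edge⊆ (edge-closed h) g∈) (edge⊆ (edge-closed g) (∈-edge-sym g∈))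

  edge-α : ∀ h → edge (α h) ≡ edge h
  edge-α h = edge-≡ (αh∈edge h)

  Closed-∪ : ∀ {A B} → Closed M A → Closed M B → Closed M (A ∪ B)
  Closed-∪ {A} {B} closedA closedB h h∈ =
    x∈p∪q⁺ (Sum.map (closedA h) (closedB h) (x∈p∪q⁻ A B h∈))

  Closed-∩ : ∀ {A B} → Closed M A → Closed M B → Closed M (A ∩ B)
  Closed-∩ {A} {B} closedA closedB h h∈ =
    x∈p∩q⁺ (closedA h (p∩q⊆p A B h∈) , closedB h (p∩q⊆q A B h∈))

  Closed-∁ : ∀ {A} → Closed M A → Closed M (∁ A)
  Closed-∁ closed h h∈ =
    x∉p⇒x∈∁p (λ αh∈ → x∈∁p⇒x∉p h∈ (subst (_∈ _) (α-inv h) (closed _ αh∈)))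

  Closed-∖edge : ∀ {A} → Closed M A → ∀ h → Closed M (A ∩ ∁ (edge h))
  Closed-∖edge closed h = Closed-∩ closed (Closed-∁ (edge-closed h))

  ∼-refl : ∀ {h} → h ∼ h
  ∼-refl = 0 , refl

  ∼-trans : ∀ {a b c} → a ∼ b → b ∼ c → a ∼ c
  ∼-trans {a} (j , refl) (k , refl) = k + j , iter-+ (σf M) k j a

  h∼σh : ∀ h → h ∼ σf M h
  h∼σh h = 1 , refl

  ∼-sym : ∀ {a b} → a ∼ b → b ∼ a
  ∼-sym {a} (k , refl) with d , _ , periodic ← iter-period (σf M) σ-injective a = k * d , (begin
    iter σ′ (k * d) (iter σ′ k a)  ≡⟨ iter-+ σ′ (k * d) k a ⟨
    iter σ′ (k * d + k) a          ≡⟨ cong (λ i → iter σ′ i a) k*d+k≡k*[1+d] ⟩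
    iter σ′ (k * suc d) a          ≡⟨ iter-periodic-* σ′ periodic k ⟩
    a                              ∎)
    where
    σ′ : Fin n → Fin n
    σ′ = σf M
    k*d+k≡k*[1+d] : k * d + k ≡ k * suc d
    k*d+k≡k*[1+d] = trans (+-comm (k * d) k) (sym (*-suc k d))
    open ≡-Reasoning

  ∼-within-n : ∀ {a b} → a ∼ b → ∃ λ (k : Fin n) → iter (σf M) (toℕ k) a ≡ b
  ∼-within-n {a} (k , refl) with d , d<n , periodic ← iter-period (σf M) σ-injective a =
    fromℕ< k%<n ,
    trans (cong (λ i → iter (σf M) i a) (toℕ-fromℕ< k%<n)) (iter-periodic-% (σf M) periodic k)
    where
    k%<n : k % suc d < n
    k%<n = <-≤-trans (m%n<n k (suc d)) d<n

  _∼?_ : ∀ a b → Dec (a ∼ b)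
  a ∼? b = map′ (λ (k , eq) → toℕ k , eq) ∼-within-n (any? λ k → iter (σf M) (toℕ k) a ≟ b)

  walk-∼ : ∀ {A x y} → x ∼ y → Walk A x y
  walk-∼ x∼y = inj₁ x∼y ◅ ε

  walk-α : ∀ {A x} → x ∈ A → Walk A x (α x)
  walk-α x∈A = inj₂ (x∈A , refl) ◅ ε

  walk-mono : ∀ {A B} → A ⊆ B → ∀ {x y} → Walk A x y → Walk B x y
  walk-mono A⊆B = Star.map (Sum.map₂ (λ (x∈A , eq) → A⊆B x∈A , eq))

  walk-reverse : ∀ {A} → Closed M A → ∀ {x y} → Walk A x y → Walk A y x
  walk-reverse closed = reverse adj-sym
    where
    adj-sym : ∀ {x y} → Adj M _ x y → Adj M _ y x
    adj-sym (inj₁ x∼y)         = inj₁ (∼-sym x∼y)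
    adj-sym (inj₂ (x∈A , refl)) = inj₂ (closed _ x∈A , sym (α-inv _))

  walk-split : ∀ {A} g {x y} → Walk A x y →
               Walk (A ∩ ∁ (edge g)) x y ⊎ ∃ λ z → z ∈ edge g × Walk (A ∩ ∁ (edge g)) x z
  walk-split g ε = inj₁ ε
  walk-split g (inj₁ x∼ ◅ w) =
    Sum.map (inj₁ x∼ ◅_) (λ (z , z∈ , w′) → z , z∈ , inj₁ x∼ ◅ w′) (walk-split g w)
  walk-split {A} g {x} (inj₂ (x∈A , eq) ◅ w) with x ∈? edge g
  ... | yes x∈g = inj₂ (x , x∈g , ε)
  ... | no  x∉g = Sum.map (step ◅_) (λ (z , z∈ , w′) → z , z∈ , step ◅ w′) (walk-split g w)
    where
    step : Adj M (A ∩ ∁ (edge g)) x _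
    step = inj₂ (x∈p∩q⁺ (x∈A , x∉p⇒x∈∁p x∉g) , eq)

  walk-bypassing : ∀ {A A′} → Closed M A → ∀ {h} → Walk A (α h) h →
                   (∀ {x} → x ∈ A′ → x ∈ A ⊎ x ∈ edge h) →
                   ∀ {x y} → Walk A′ x y → Walk A x y
  walk-bypassing closed {h} bypass A′⊆ = Star.fold (Walk _) (λ step w → reroute step ◅◅ w) ε
    where
    reroute : ∀ {x y} → Adj M _ x y → Walk _ x y
    reroute (inj₁ x∼y) = walk-∼ x∼y
    reroute (inj₂ (x∈A′ , refl)) with A′⊆ x∈A′
    ... | inj₁ x∈A = walk-α x∈A
    ... | inj₂ x∈h with ∈-edge⁻ x∈h
    ...   | inj₁ refl = walk-reverse closed bypass
    ...   | inj₂ refl = subst (Walk _ (α h)) (sym (α-inv h)) bypass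

  -- Simple paths and cycles

  data Path (A : Subset n) : Fin n → Fin n → ℕ → Set where
    stay : ∀ {x y} → x ∼ y → Path A x y 0
    hop  : ∀ {x y m} p → x ∼ p → p ∈ A → Path A (α p) y m → Path A x y (suc m)

  visit : ∀ {A x y m} → Path A x y m → Fin (suc m) → Fin n
  visit {x = x} P             zero    = x
  visit         (hop _ _ _ P) (suc i) = visit P i

  leave : ∀ {A x y m} → Path A x y m → Fin m → Fin n
  leave (hop p _ _ _) zero    = p
  leave (hop _ _ _ P) (suc i) = leave P i

  visit-∼-leave : ∀ {A x y m} (P : Path A x y m) i → visit P (inject₁ i) ∼ leave P i
  visit-∼-leave (hop _ x∼p _ _) zero    = x∼p
  visit-∼-leave (hop _ _ _ P)   (suc i) = visit-∼-leave P i

  visit-suc : ∀ {A x y m} (P : Path A x y m) i → visit P (suc i) ≡ α (leave P i)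
  visit-suc (hop _ _ _ _) zero    = refl
  visit-suc (hop _ _ _ P) (suc i) = visit-suc P i

  visit-last : ∀ {A x y m} (P : Path A x y m) → visit P (fromℕ m) ∼ y
  visit-last (stay x∼y)    = x∼y
  visit-last (hop _ _ _ P) = visit-last P

  leave-∈ : ∀ {A x y m} (P : Path A x y m) i → leave P i ∈ A
  leave-∈ (hop _ _ p∈A _) zero    = p∈A
  leave-∈ (hop _ _ _ P)   (suc i) = leave-∈ P i

  Simple : ∀ {A x y m} → Path A x y m → Set
  Simple P = ∀ {i j} → visit P i ∼ visit P j → i ≡ j

  SimplePath : Subset n → Fin n → Fin n → Set
  SimplePath A x y = ∃₂ λ m (P : Path A x y m) → Simple P

  module _ {A : Subset n} {x z y : Fin n} (x∼z : x ∼ z) where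

    reroot : ∀ {m} → Path A z y m → Path A x y m
    reroot (stay z∼y)       = stay (∼-trans x∼z z∼y)
    reroot (hop p z∼p p∈ P) = hop p (∼-trans x∼z z∼p) p∈ P

    visit-reroot : ∀ {m} (P : Path A z y m) i → visit (reroot P) i ∼ visit P i
    visit-reroot P             zero    = x∼z
    visit-reroot (hop _ _ _ P) (suc i) = ∼-refl

    reroot-simple : ∀ {m} (P : Path A z y m) → Simple P → Simple (reroot P)
    reroot-simple P simple {i} {j} v =
      simple (∼-trans (∼-sym (visit-reroot P i)) (∼-trans v (visit-reroot P j)))

  suffix : ∀ {A} x {z y m} (P : Path A z y m) → Simple P →
           SimplePath A x y ⊎ (∀ i → ¬ x ∼ visit P i)
  suffix x {z} P simple with x ∼? z
  ... | yes x∼z = inj₁ (_ , reroot x∼z P , reroot-simple x∼z P simple)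
  suffix x (stay _)      simple | no x≁z = inj₂ λ where zero → x≁z
  suffix x (hop _ _ _ P) simple | no x≁z with suffix x P (λ v → suc-injective (simple v))
  ... | inj₁ found  = inj₁ found
  ... | inj₂ avoids = inj₂ λ where
    zero    → x≁z
    (suc i) → avoids i

  walk⇒simplePath : ∀ {A x y} → Walk A x y → SimplePath A x y
  walk⇒simplePath ε = 0 , stay ∼-refl , λ { {zero} {zero} _ → refl }
  walk⇒simplePath (inj₁ x∼z ◅ w) with m , P , simple ← walk⇒simplePath w =
    m , reroot x∼z P , reroot-simple x∼z P simple
  walk⇒simplePath {x = x} (inj₂ (x∈A , refl) ◅ w) with m , P , simple ← walk⇒simplePath w
                                                   with suffix x P simple
  ... | inj₁ found  = found
  ... | inj₂ avoids = suc m , hop x ∼-refl x∈A P , simple′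
    where
    simple′ : Simple (hop x ∼-refl x∈A P)
    simple′ {zero}  {zero}  _ = refl
    simple′ {zero}  {suc j} v = ⊥-elim (avoids j v)
    simple′ {suc i} {zero}  v = ⊥-elim (avoids i (∼-sym v))
    simple′ {suc i} {suc j} v = cong suc (simple v)

  module ClosingCycle {A} (closed : Closed M A) {h} (h∈A : h ∈ A)
                      {m} (P : Path (A ∩ ∁ (edge h)) (α h) h m) (simple : Simple P) where

    around : Fin (suc m) → Fin n
    around zero    = h
    around (suc i) = leave P i

    leave∉edge : ∀ i → leave P i ∉ edge h
    leave∉edge i = x∈∁p⇒x∉p (p∩q⊆q A _ (leave-∈ P i))

    around-∈ : ∀ i → around i ∈ A
    around-∈ zero    = h∈A
    around-∈ (suc i) = p∩q⊆p A _ (leave-∈ P i)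

    α-around : ∀ j → α (around j) ≡ visit P j
    α-around zero    = refl
    α-around (suc i) = sym (visit-suc P i)

    position : Fin (suc m) → Fin (suc m)
    position zero    = fromℕ m
    position (suc i) = inject₁ i

    position-injective : Injective _≡_ _≡_ position
    position-injective {zero}  {zero}  _  = refl
    position-injective {zero}  {suc _} eq = ⊥-elim (fromℕ≢inject₁ eq)
    position-injective {suc _} {zero}  eq = ⊥-elim (fromℕ≢inject₁ (sym eq))
    position-injective {suc _} {suc _} eq = cong suc (inject₁-injective eq)

    around-∼ : ∀ j → around j ∼ visit P (position j)
    around-∼ zero    = ∼-sym (visit-last P)
    around-∼ (suc i) = ∼-sym (visit-∼-leave P i)

    consecutive : ∀ (i : Fin m) → α (around (inject₁ i)) ∼ around (suc i)
    consecutive i = subst (_∼ leave P i) (sym (α-around (inject₁ i))) (visit-∼-leave P i)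

    closing : α (around (fromℕ m)) ∼ around zero
    closing = subst (_∼ h) (sym (α-around (fromℕ m))) (visit-last P)

    distinct-vertices : ∀ i j → i ≢ j → ¬ around i ∼ around j
    distinct-vertices i j i≢j v =
      i≢j (position-injective (simple (∼-trans (∼-sym (around-∼ i)) (∼-trans v (around-∼ j)))))

    backtrack-next : ∀ {k l} → leave P k ≡ α (leave P l) → suc (toℕ k) ≡ toℕ l
    backtrack-next {k} {l} eq = trans (cong toℕ (simple v)) (toℕ-inject₁ l)
      where
      v : visit P (suc k) ∼ visit P (inject₁ l)
      v = subst (_∼ visit P (inject₁ l))
                (sym (trans (visit-suc P k) (trans (cong α eq) (α-inv (leave P l)))))
                (∼-sym (visit-∼-leave P l))

    distinct-edges : ∀ i j → i ≢ j → around i ≢ α (around j)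
    distinct-edges zero    zero    i≢j _  = i≢j refl
    distinct-edges zero    (suc l) _   eq =
      leave∉edge l (subst (_∈ edge h) (trans (cong α eq) (α-inv (leave P l))) (αh∈edge h))
    distinct-edges (suc k) zero    _   eq = leave∉edge k (subst (_∈ edge h) (sym eq) (αh∈edge h))
    -- A repeated edge would be an immediate backtrack in both directions, so k + 2 = k.
    distinct-edges (suc k) (suc l) _   eq = <-irrefl (sym k+2≡k) (m<n⇒m<1+n (n<1+n (toℕ k)))
      where
      eq′ : leave P l ≡ α (leave P k)
      eq′ = trans (sym (α-inv (leave P l))) (cong α (sym eq))
      k+2≡k : suc (suc (toℕ k)) ≡ toℕ k
      k+2≡k = trans (cong suc (backtrack-next eq)) (backtrack-next eq′)

    OnCycle : Fin n → Set
    OnCycle g = ∃ λ i → g ≡ around i ⊎ g ≡ α (around i)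

    OnCycle? : Decidable OnCycle
    OnCycle? g = any? (λ i → (g ≟ around i) ⊎-dec (g ≟ α (around i)))

    cycle : Subset n
    cycle = subset OnCycle?

    isCycle : IsCycle M cycle
    isCycle = m , around , consecutive , closing , distinct-vertices
            , (λ i j i≢j → (λ eq → distinct-vertices i j i≢j (subst (around i ∼_) eq ∼-refl))
                         , distinct-edges i j i≢j)
            , λ g → ∈-subset⁻ OnCycle? , ∈-subset⁺ OnCycle?

    cycle⊆A : cycle ⊆ A
    cycle⊆A g∈ with ∈-subset⁻ OnCycle? g∈
    ... | i , inj₁ refl = around-∈ i
    ... | i , inj₂ refl = closed _ (around-∈ i)

    h∈cycle : h ∈ cycle
    h∈cycle = ∈-subset⁺ OnCycle? (zero , inj₁ refl)

  opaque
    cycle-through : ∀ {A} → Closed M A → ∀ {h} → h ∈ A → Walk (A ∩ ∁ (edge h)) (α h) h →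
                    ∃ λ C → IsCycle M C × C ⊆ A × h ∈ C
    cycle-through closed h∈A w with _ , P , simple ← walk⇒simplePath w =
      cycle , isCycle , cycle⊆A , h∈cycle
      where open ClosingCycle closed h∈A P simple

  cycle-closed : ∀ {C} → IsCycle M C → Closed M C
  cycle-closed (_ , _ , _ , _ , _ , _ , mem) g g∈ with proj₁ (mem g) g∈
  ... | i , inj₁ refl = proj₂ (mem _) (i , inj₂ refl)
  ... | i , inj₂ refl = proj₂ (mem _) (i , inj₁ (α-inv _))

  module CycleBypass {m} (hs : Fin (suc m) → Fin n)
      (consecutive : ∀ (i : Fin m) → α (hs (inject₁ i)) ∼ hs (suc i))
      (closing : α (hs (fromℕ m)) ∼ hs zero)
      (distinct-edges : ∀ i j → i ≢ j → (hs i ≢ hs j) × (hs i ≢ α (hs j)))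
      {C} (hs∈C : ∀ i → hs i ∈ C) (i : Fin (suc m)) where

    B : Subset n
    B = C ∩ ∁ (edge (hs i))

    -- The cycle read by natural-number index (clamped to m), so that walks along it are built
    -- by induction on ℕ.
    clamp : ℕ → Fin (suc m)
    clamp k with k <? suc m
    ... | yes k<1+m = fromℕ< k<1+m
    ... | no  _     = zero

    toℕ-clamp : ∀ {k} → k ≤ m → toℕ (clamp k) ≡ k
    toℕ-clamp {k} k≤m with k <? suc m
    ... | yes k<1+m = toℕ-fromℕ< k<1+m
    ... | no  k≮1+m = ⊥-elim (k≮1+m (s≤s k≤m))

    at : ℕ → Fin n
    at k = hs (clamp k)

    hs≡at : ∀ j {k} → toℕ j ≡ k → hs j ≡ at k
    hs≡at j {k} refl = cong hs (toℕ-injective (sym (toℕ-clamp (≤-pred (toℕ<n j)))))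

    at-step : ∀ {k} → k < m → α (at k) ∼ at (suc k)
    at-step {k} k<m = subst₂ (λ a b → α a ∼ b)
      (hs≡at (inject₁ j) (trans (toℕ-inject₁ j) (toℕ-fromℕ< k<m)))
      (hs≡at (suc j) (cong suc (toℕ-fromℕ< k<m)))
      (consecutive j)
      where
      j : Fin m
      j = fromℕ< k<m

    at-close : α (at m) ∼ at 0
    at-close =
      subst₂ (λ a b → α a ∼ b) (hs≡at (fromℕ m) (toℕ-fromℕ m)) (hs≡at zero refl) closing

    at-∈ : ∀ {l} → l ≤ m → l ≢ toℕ i → at l ∈ B
    at-∈ {l} l≤m l≢i =
      x∈p∩q⁺ (hs∈C (clamp l) , x∉p⇒x∈∁p (Sum.[ proj₁ distinct , proj₂ distinct ] ∘ ∈-edge⁻))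
      where
      distinct : (hs (clamp l) ≢ hs i) × (hs (clamp l) ≢ α (hs i))
      distinct = distinct-edges (clamp l) i λ eq → l≢i (trans (sym (toℕ-clamp l≤m)) (cong toℕ eq))

    along : ∀ {a b} → a ≤′ b → b ≤ m → (∀ {l} → a ≤ l → l < b → l ≢ toℕ i) →
            Walk B (at a) (at b)
    along ≤′-refl _ _ = ε
    along (≤′-step {n = b} a≤′b) b<m avoids =
      along a≤′b (<⇒≤ b<m) (λ a≤l l<b → avoids a≤l (m<n⇒m<1+n l<b))
      ◅◅ walk-α (at-∈ (<⇒≤ b<m) (avoids (≤′⇒≤ a≤′b) (n<1+n b)))
      ◅◅ walk-∼ (at-step b<m)

    i≤m : toℕ i ≤ m
    i≤m = ≤-pred (toℕ<n i)

    to-start : Walk B (α (at (toℕ i))) (at 0)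
    to-start with toℕ i <? m
    ... | yes i<m = walk-∼ (at-step i<m) ◅◅ along (≤⇒≤′ i<m) ≤-refl (λ i<l _ → >⇒≢ i<l)
                    ◅◅ walk-α (at-∈ ≤-refl (>⇒≢ i<m)) ◅◅ walk-∼ at-close
    ... | no  i≮m =
      subst (λ k → Walk B (α (at k)) (at 0)) (sym (≤∧≮⇒≡ i≤m i≮m)) (walk-∼ at-close)

    from-start : Walk B (at 0) (at (toℕ i))
    from-start = along (≤⇒≤′ z≤n) i≤m (λ _ l<i → <⇒≢ l<i)

    bypass : Walk B (α (hs i)) (hs i)
    bypass = subst (λ g → Walk B (α g) g) (sym (hs≡at i refl)) (to-start ◅◅ from-start)

  cycle-bypass : ∀ {C} → IsCycle M C → ∀ {c} → c ∈ C → Walk (C ∩ ∁ (edge c)) (α c) c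
  cycle-bypass cyc@(_ , hs , consecutive , closing , _ , distinct , mem) {c} c∈
    with proj₁ (mem c) c∈
  ... | i , inj₁ refl = bypass
    where open CycleBypass hs consecutive closing distinct (λ j → proj₂ (mem _) (j , inj₁ refl)) i
  ... | i , inj₂ refl rewrite edge-α (hs i) | α-inv (hs i) =
    walk-reverse (Closed-∖edge (cycle-closed cyc) (hs i)) bypass
    where open CycleBypass hs consecutive closing distinct (λ j → proj₂ (mem _) (j , inj₁ refl)) i

  motion-∈ : ∀ {A h} → h ∈ A → motion M A h ≡ σf M (α h)
  motion-∈ {A} {h} h∈A with h ∈? A
  ... | yes _   = refl
  ... | no  h∉A = ⊥-elim (h∉A h∈A)

  motion-∉ : ∀ {A h} → h ∉ A → motion M A h ≡ σf M h
  motion-∉ {A} {h} h∉A with h ∈? A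
  ... | yes h∈A = ⊥-elim (h∉A h∈A)
  ... | no  _   = refl

  motion-cong : ∀ {A B h} → (h ∈ A → h ∈ B) → (h ∈ B → h ∈ A) → motion M A h ≡ motion M B h
  motion-cong {A} {B} {h} A⇒B B⇒A with h ∈? A
  ... | yes h∈A = sym (motion-∈ (A⇒B h∈A))
  ... | no  h∉A = sym (motion-∉ (h∉A ∘ B⇒A))

  motion-injective : ∀ {A} → Closed M A → Injective _≡_ _≡_ (motion M A)
  motion-injective {A} closed {a} {b} eq with a ∈? A | b ∈? A
  ... | yes _   | yes _   = α-injective (σ-injective eq)
  ... | no  _   | no  _   = σ-injective eq
  ... | yes a∈A | no  b∉A = ⊥-elim (b∉A (subst (_∈ A) (σ-injective eq) (closed a a∈A)))
  ... | no  a∉A | yes b∈A = ⊥-elim (a∉A (subst (_∈ A) (σ-injective (sym eq)) (closed b b∈A)))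

  -- Spanning trees

  module Tree {T : Subset n} (tree : SpanningTree M T) where

    closed : Closed M T
    closed = proj₁ tree

    connected : Connected M T
    connected = proj₁ (proj₂ tree)

    acyclic : ∀ C → IsCycle M C → ¬ C ⊆ T
    acyclic = proj₂ (proj₂ tree)

    ∉T-edge : ∀ {c x} → c ∉ T → x ∈ edge c → x ∉ T
    ∉T-edge c∉T x∈c x∈T = c∉T (edge⊆ closed x∈T (∈-edge-sym x∈c))

    bridge : ∀ {g} → g ∈ T → ¬ Walk (T ∩ ∁ (edge g)) (α g) g
    bridge g∈T w with C , cycle , C⊆T , _ ← cycle-through closed g∈T w = acyclic C cycle C⊆T

    module Cut {g} (g∈T : g ∈ T) where

      B : Subset n
      B = T ∩ ∁ (edge g)

      closedB : Closed M B
      closedB = Closed-∖edge closed g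

      endpoint : Bool → Fin n
      endpoint true  = g
      endpoint false = α g

      toward : ∀ z → Walk B z g ⊎ Walk B z (α g)
      toward z with walk-split g (connected z g)
      ... | inj₁ w = inj₁ w
      ... | inj₂ (x , x∈g , w) with ∈-edge⁻ x∈g
      ...   | inj₁ refl = inj₁ w
      ...   | inj₂ refl = inj₂ w

      -- The end of g to which z is joined in T ∖ g; by bridge it is never joined to both.
      side : Fin n → Bool
      side z = Sum.[ (λ _ → true) , (λ _ → false) ] (toward z)

      to-side : ∀ z → Walk B z (endpoint (side z))
      to-side z with toward z
      ... | inj₁ w = w
      ... | inj₂ w = w

      endpoint-walk : ∀ {b b′} → Walk B (endpoint b) (endpoint b′) → b ≡ b′
      endpoint-walk {true}  {true}  _ = refl
      endpoint-walk {false} {false} _ = refl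
      endpoint-walk {true}  {false} w = ⊥-elim (bridge g∈T (walk-reverse closedB w))
      endpoint-walk {false} {true}  w = ⊥-elim (bridge g∈T w)

      side-walk : ∀ {z z′} → Walk B z z′ → side z ≡ side z′
      side-walk {z} {z′} w = endpoint-walk (walk-reverse closedB (to-side z) ◅◅ w ◅◅ to-side z′)

      side-endpoint : ∀ b → side (endpoint b) ≡ b
      side-endpoint b = sym (endpoint-walk (to-side (endpoint b)))

      Crosses : Fin n → Set
      Crosses c = side c ≢ side (α c)

      Crosses? : Decidable Crosses
      Crosses? c = ¬? (side c Bool.≟ side (α c))

      g-crosses : Crosses g
      g-crosses eq = true≢false (trans (sym (side-endpoint true)) (trans eq (side-endpoint false)))
        where
        true≢false : true ≢ false
        true≢false ()

      Crosses-α : ∀ {c} → Crosses c → Crosses (α c)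
      Crosses-α {c} crosses eq = crosses (sym (trans eq (cong side (α-inv c))))

      ¬Crosses-B : ∀ {c} → c ∈ B → ¬ Crosses c
      ¬Crosses-B c∈B crosses = crosses (side-walk (walk-α c∈B))

      crossing-∈-edge : ∀ {c} → c ∈ T → Crosses c → c ∈ edge g
      crossing-∈-edge {c} c∈T crosses with c ∈? edge g
      ... | yes c∈g = c∈g
      ... | no  c∉g = ⊥-elim (¬Crosses-B (x∈p∩q⁺ (c∈T , x∉p⇒x∈∁p c∉g)) crosses)

      crossing-step : ∀ {A x y} → Walk A x y → side x ≢ side y → ∃ λ c → c ∈ A × Crosses c
      crossing-step ε sides = ⊥-elim (sides refl)
      crossing-step (inj₁ x∼z ◅ w) sides = crossing-step w (sides ∘ trans (side-walk (walk-∼ x∼z)))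
      crossing-step {x = x} (inj₂ (x∈A , refl) ◅ w) sides with side x Bool.≟ side (α x)
      ... | no  crosses = x , x∈A , crosses
      ... | yes same    = crossing-step w (sides ∘ trans same)

      reconnect : ∀ {A} → Closed M A → B ⊆ A → ∀ {c} → c ∈ A → Crosses c → Connected M A
      reconnect {A} closedA B⊆A {c} c∈A crosses x y =
        to-sideᴬ x ◅◅ link (side x) (side y) ◅◅ walk-reverse closedA (to-sideᴬ y)
        where
        to-sideᴬ : ∀ z → Walk A z (endpoint (side z))
        to-sideᴬ z = walk-mono B⊆A (to-side z)
        across : Walk A (endpoint (side c)) (endpoint (side (α c)))
        across = walk-reverse closedA (to-sideᴬ c) ◅◅ walk-α c∈A ◅◅ to-sideᴬ (α c)
        g⇝αg : Walk A g (α g)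
        g⇝αg with side c | side (α c) | across
        ... | true  | false | w = w
        ... | false | true  | w = walk-reverse closedA w
        ... | true  | true  | _ = ⊥-elim (crosses refl)
        ... | false | false | _ = ⊥-elim (crosses refl)
        link : ∀ b b′ → Walk A (endpoint b) (endpoint b′)
        link true  true  = ε
        link false false = ε
        link true  false = g⇝αg
        link false true  = walk-reverse closedA g⇝αg

      cycle-crossing : ∀ {C} → IsCycle M C → g ∈ C → ∃ λ c → c ∈ C × c ∉ edge g × Crosses c
      cycle-crossing {C} cycle g∈C
        with c , c∈ , crosses ← crossing-step (cycle-bypass cycle g∈C) (g-crosses ∘ sym) =
        c , p∩q⊆p C _ c∈ , x∈∁p⇒x∉p (p∩q⊆q C _ c∈) , crosses

      cocycle : Subset n
      cocycle = subset Crosses?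

      g∈cocycle : g ∈ cocycle
      g∈cocycle = ∈-subset⁺ Crosses? g-crosses

      isCocycle : IsCocycle M cocycle
      isCocycle = (λ c c∈ → ∈-subset⁺ Crosses? (Crosses-α (∈-subset⁻ Crosses? c∈)))
                , disconnected , minimal
        where
        disconnected : ¬ Connected M (∁ cocycle)
        disconnected conn with c , c∉ , crosses ← crossing-step (conn g (α g)) g-crosses =
          x∈∁p⇒x∉p c∉ (∈-subset⁺ Crosses? crosses)
        minimal : ∀ D → Closed M D → D ⊆ cocycle → D ≢ cocycle → Connected M (∁ D)
        minimal D closedD D⊆ D≢ with c , c∈ , c∉D ← ⊂-witness D⊆ D≢ =
          reconnect (Closed-∁ closedD) B⊆∁D (x∉p⇒x∈∁p c∉D) (∈-subset⁻ Crosses? c∈)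
          where
          B⊆∁D : B ⊆ ∁ D
          B⊆∁D x∈B = x∉p⇒x∈∁p (λ x∈D → ¬Crosses-B x∈B (∈-subset⁻ Crosses? (D⊆ x∈D)))

    t : Fin n → Fin n
    t = motion M T

    t-injective : Injective _≡_ _≡_ t
    t-injective = motion-injective closed

    τ : ℕ → Fin n
    τ k = iter t k root

    InTour : Fin n → Set
    InTour g = ∃ λ k → τ k ≡ g

    Beside : Fin n → Fin n → Set
    Beside h z = Walk (T ∩ ∁ (edge h)) (α h) z

    beside-t : ∀ {h} → h ∈ T → Beside h (t h)
    beside-t {h} h∈T = subst (Beside h) (sym (motion-∈ h∈T)) (walk-∼ (h∼σh (α h)))

    beside-step : ∀ {h z} → h ∈ T → Beside h z → z ≢ α h → Beside h (t z)
    beside-step {h} {z} h∈T w z≢αh with z ∈? T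
    ... | no  _ = w ◅◅ walk-∼ (h∼σh z)
    ... | yes z∈T with z ∈? edge h
    ...   | no  z∉h =
      w ◅◅ walk-α (x∈p∩q⁺ (z∈T , x∉p⇒x∈∁p z∉h)) ◅◅ walk-∼ (h∼σh (α z))
    ...   | yes z∈h with ∈-edge⁻ z∈h
    ...     | inj₁ refl = ⊥-elim (bridge h∈T w)
    ...     | inj₂ refl = ⊥-elim (z≢αh refl)

    -- Leaving h, the tour stays beside α h until it reaches α h; it cannot come back to h
    -- first, as T ∖ h has no walk from α h to h.
    returns-through-α : ∀ {h} → h ∈ T → ∃ λ i → iter t i (t h) ≡ α h
    returns-through-α {h} h∈T
      with d , _ , periodic ← iter-period t t-injective h
      with iter-invariant-until _≟_ t (beside-step h∈T) d (beside-t h∈T)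
    ... | inj₂ found = found
    ... | inj₁ w = ⊥-elim (bridge h∈T (subst (Beside h) (trans (iter-sucʳ t d h) periodic) w))

    InTour-t : ∀ {g} → InTour g → InTour (t g)
    InTour-t (k , refl) = suc k , refl

    InTour-α : ∀ {h} → h ∈ T → InTour h → InTour (α h)
    InTour-α {h} h∈T (k , refl) with i , found ← returns-through-α h∈T =
      i + suc k , trans (iter-+ t i (suc k) root) found

    InTour-σ : ∀ {g} → InTour g → InTour (σf M g)
    InTour-σ {g} inTour with g ∈? T
    ... | no  g∉T = subst InTour (motion-∉ g∉T) (InTour-t inTour)
    ... | yes g∈T = subst InTour (trans (motion-∈ (closed g g∈T)) (cong (σf M) (α-inv g)))
                                 (InTour-t (InTour-α g∈T inTour))

    InTour-∼ : ∀ {g g′} → g ∼ g′ → InTour g → InTour g′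
    InTour-∼ (zero  , refl) inTour = inTour
    InTour-∼ (suc k , refl) inTour = InTour-σ (InTour-∼ (k , refl) inTour)

    InTour-walk : ∀ {g g′} → Walk T g g′ → InTour g → InTour g′
    InTour-walk ε                      inTour = inTour
    InTour-walk (inj₁ g∼ ◅ w)           inTour = InTour-walk w (InTour-∼ g∼ inTour)
    InTour-walk (inj₂ (g∈T , refl) ◅ w) inTour = InTour-walk w (InTour-α g∈T inTour)

    all-in-tour : ∀ g → InTour g
    all-in-tour g = InTour-walk (connected root g) (0 , refl)

    open CoveringOrbit t t-injective root all-in-tour public
      renaming (iter-m to τ-n; iter-injective to τ-injective; iter-surjective to τ-surjective)
      using (exact-period)

    exchange : ∀ {g} (g∈T : g ∈ T) {c} → Cut.Crosses g∈T c →
               SpanningTree M ((T ∩ ∁ (edge g)) ∪ edge c)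
    exchange {g} g∈T {c} crosses =
      closedA , reconnect closedA (p⊆p∪q (edge c)) (q⊆p∪q B (edge c) (h∈edge c)) crosses , acyclicA
      where
      open Cut g∈T
      A : Subset n
      A = B ∪ edge c
      closedA : Closed M A
      closedA = Closed-∪ closedB (edge-closed c)
      ∈B : ∀ {x} → x ∈ A → x ∉ edge c → x ∈ B
      ∈B {x} x∈A x∉c with x∈p∪q⁻ B (edge c) x∈A
      ... | inj₁ x∈B = x∈B
      ... | inj₂ x∈c = ⊥-elim (x∉c x∈c)
      acyclicA : ∀ C → IsCycle M C → ¬ C ⊆ A
      acyclicA C cycle C⊆A with c ∈? C
      ... | yes c∈C = crosses (sym (side-walk (walk-mono C∖c⊆B (cycle-bypass cycle c∈C))))
        where
        C∖c⊆B : C ∩ ∁ (edge c) ⊆ B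
        C∖c⊆B x∈ = ∈B (C⊆A (p∩q⊆p C _ x∈)) (x∈∁p⇒x∉p (p∩q⊆q C _ x∈))
      ... | no  c∉C = acyclic C cycle (p∩q⊆p T _ ∘ C⊆B)
        where
        C⊆B : C ⊆ B
        C⊆B x∈C = ∈B (C⊆A x∈C) λ x∈c →
          c∉C (edge⊆ (cycle-closed cycle) x∈C (∈-edge-sym x∈c))

    module FundamentalCycle {h} (h∉T : h ∉ T) where

      A : Subset n
      A = T ∪ edge h

      T⊆A∖h : T ⊆ A ∩ ∁ (edge h)
      T⊆A∖h x∈T =
        x∈p∩q⁺ (p⊆p∪q (edge h) x∈T , x∉p⇒x∈∁p (λ x∈h → ∉T-edge h∉T x∈h x∈T))

      fundamental : ∃ λ C → IsCycle M C × C ⊆ A × h ∈ C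
      fundamental = cycle-through (Closed-∪ closed (edge-closed h)) (q⊆p∪q T (edge h) (h∈edge h))
                                  (walk-mono T⊆A∖h (connected (α h) h))

      C : Subset n
      C = proj₁ fundamental

      isCycle : IsCycle M C
      isCycle = proj₁ (proj₂ fundamental)

      C⊆A : C ⊆ A
      C⊆A = proj₁ (proj₂ (proj₂ fundamental))

      h∈C : h ∈ C
      h∈C = proj₂ (proj₂ (proj₂ fundamental))

      C∖h⊆T : C ∩ ∁ (edge h) ⊆ T
      C∖h⊆T {x} x∈ with x∈p∪q⁻ T (edge h) (C⊆A (p∩q⊆p C _ x∈))
      ... | inj₁ x∈T = x∈T
      ... | inj₂ x∈h = ⊥-elim (x∈∁p⇒x∉p (p∩q⊆q C _ x∈) x∈h)

      crosses : ∀ {g} → g ∈ C → (g∈T : g ∈ T) → Cut.Crosses g∈T h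
      crosses g∈C g∈T with c , c∈C , c∉g , c-crosses ← Cut.cycle-crossing g∈T isCycle g∈C
                      with x∈p∪q⁻ T (edge h) (C⊆A c∈C)
      ... | inj₁ c∈T = ⊥-elim (c∉g (Cut.crossing-∈-edge g∈T c∈T c-crosses))
      ... | inj₂ c∈h with ∈-edge⁻ c∈h
      ...   | inj₁ refl = c-crosses
      ...   | inj₂ refl = subst (Cut.Crosses g∈T) (α-inv h) (Cut.Crosses-α g∈T c-crosses)

      meets-cocycle : ∀ {D} → IsCocycle M D → h ∈ D → ∃ λ g → g ∈ C × g ∈ T × g ∈ D
      meets-cocycle {D} (closedD , disconnected , minimal) h∈D
        with any? (λ g → (g ∈? C) ×-dec (g ∈? T) ×-dec (g ∈? D))
      ... | yes found = found
      ... | no  none  =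
        ⊥-elim (disconnected λ x y → walk-bypassing (Closed-∁ closedD) bypass ∉D′ (conn x y))
        where
        D′ : Subset n
        D′ = D ∩ ∁ (edge h)
        conn : Connected M (∁ D′)
        conn = minimal D′ (Closed-∖edge closedD h) (p∩q⊆p D _)
                 (λ eq → x∈∁p⇒x∉p (p∩q⊆q D _ (subst (h ∈_) (sym eq) h∈D)) (h∈edge h))
        bypass : Walk (∁ D) (α h) h
        bypass = walk-mono C∖h⊆∁D (cycle-bypass isCycle h∈C)
          where
          C∖h⊆∁D : C ∩ ∁ (edge h) ⊆ ∁ D
          C∖h⊆∁D {x} x∈ = x∉p⇒x∈∁p λ x∈D → none (x , p∩q⊆p C _ x∈ , C∖h⊆T x∈ , x∈D)
        ∉D′ : ∀ {x} → x ∈ ∁ D′ → x ∈ ∁ D ⊎ x ∈ edge h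
        ∉D′ {x} x∉ with x ∈? D | x ∈? edge h
        ... | _      | yes x∈h = inj₂ x∈h
        ... | no x∉D | no  _   = inj₁ (x∉p⇒x∈∁p x∉D)
        ... | yes x∈D | no x∉h = ⊥-elim (x∈∁p⇒x∉p x∉ (x∈p∩q⁺ (x∈D , x∉p⇒x∈∁p x∉h)))

  -- Running Δ on the tree interval of T₀

  module Interval {T₀ S : Subset n}
                  (tree : SpanningTree M T₀) (interval : InTreeInterval M T₀ S) where

    open Tree tree public

    opaque
      time : Fin n → ℕ
      time x = proj₁ (τ-surjective x)

      time<n : ∀ x → time x < n
      time<n x = proj₁ (proj₂ (τ-surjective x))

      τ-time : ∀ x → τ (time x) ≡ x
      τ-time x = proj₂ (proj₂ (τ-surjective x))

    τ-cancel : ∀ {i j} → i < n → j < n → τ i ≡ τ j → i ≡ j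
    τ-cancel {i} {j} i<n j<n eq with <-cmp i j
    ... | tri< i<j _ _ = ⊥-elim (τ-injective i<j j<n eq)
    ... | tri≈ _ i≡j _ = i≡j
    ... | tri> _ _ j<i = ⊥-elim (τ-injective j<i i<n (sym eq))

    time-τ : ∀ {k} → k < n → time (τ k) ≡ k
    time-τ {k} k<n = τ-cancel (time<n (τ k)) k<n (τ-time (τ k))

    _≺_ : Fin n → Fin n → Set
    x ≺ y = _<[_]_ M x T₀ y

    ≺⇒time< : ∀ {x y} → x ≺ y → time x < time y
    ≺⇒time< (i , j , i<j , j<n , refl , refl) =
      subst₂ _<_ (sym (time-τ (<-trans i<j j<n))) (sym (time-τ j<n)) i<j

    ≺-asym : ∀ {x y} → x ≺ y → ¬ y ≺ x
    ≺-asym x≺y y≺x = <-asym (≺⇒time< x≺y) (≺⇒time< y≺x)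

    Exchangeable : Fin n → Fin n → Set
    Exchangeable g c = SpanningTree M ((T₀ ∩ ∁ (edge g)) ∪ edge c)

    Exchangeable-edge : ∀ {g g′ c c′} → g′ ∈ edge g → c′ ∈ edge c →
                        Exchangeable g c → Exchangeable g′ c′
    Exchangeable-edge g′∈ c′∈ =
      subst₂ (λ E E′ → SpanningTree M ((T₀ ∩ ∁ E) ∪ E′)) (sym (edge-≡ g′∈)) (sym (edge-≡ c′∈))

    exchange-swap : ∀ {g c} → g ∈ T₀ → c ∉ T₀ →
                    (T₀ ∩ ∁ (edge g)) ∪ edge c ≡ (T₀ ∪ edge c) ∩ ∁ (edge g)
    exchange-swap {g} {c} g∈T₀ c∉T₀ = ⊆-antisym ⊆⇒ ⊇⇒
      where
      ⊆⇒ : (T₀ ∩ ∁ (edge g)) ∪ edge c ⊆ (T₀ ∪ edge c) ∩ ∁ (edge g)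
      ⊆⇒ {x} x∈ with x∈p∪q⁻ (T₀ ∩ ∁ (edge g)) (edge c) x∈
      ... | inj₁ x∈T₀∖g =
        x∈p∩q⁺ (p⊆p∪q (edge c) (p∩q⊆p T₀ _ x∈T₀∖g) , p∩q⊆q T₀ _ x∈T₀∖g)
      ... | inj₂ x∈c    =
        x∈p∩q⁺ (q⊆p∪q T₀ (edge c) x∈c , x∉p⇒x∈∁p (∉T-edge c∉T₀ x∈c ∘ edge⊆ closed g∈T₀))
      ⊇⇒ : (T₀ ∪ edge c) ∩ ∁ (edge g) ⊆ (T₀ ∩ ∁ (edge g)) ∪ edge c
      ⊇⇒ {x} x∈ with x∈p∪q⁻ T₀ (edge c) (p∩q⊆p (T₀ ∪ edge c) _ x∈)
      ... | inj₁ x∈T₀ = p⊆p∪q (edge c) (x∈p∩q⁺ (x∈T₀ , p∩q⊆q (T₀ ∪ edge c) _ x∈))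
      ... | inj₂ x∈c  = q⊆p∪q (T₀ ∩ ∁ (edge g)) (edge c) x∈c

    internal-minimum : ∀ {g} → g ∈ T₀ → g ∉ S →
                       ∃ λ hm → hm ∈ edge g × ∀ {c} → c ∉ T₀ → Exchangeable g c → hm ≺ c
    internal-minimum {g} g∈T₀ g∉S with g ∈? T₀ | proj₁ (proj₂ interval) g g∈T₀ g∉S
    ... | yes _    | hm , hm∈g , minimal =
      hm , hm∈g , λ c∉T₀ ex → minimal _ ex (c∉T₀ ∘ edge⊆ closed g∈T₀)
    ... | no  g∉T₀ | _ = ⊥-elim (g∉T₀ g∈T₀)

    external-minimum : ∀ {c} → c ∉ T₀ → c ∈ S →
                       ∃ λ hm → hm ∈ edge c × ∀ {g} → g ∈ T₀ → Exchangeable g c → hm ≺ g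
    external-minimum {c} c∉T₀ c∈S with c ∈? T₀ | proj₂ (proj₂ interval) c c∉T₀ c∈S
    ... | no  _    | hm , hm∈c , minimal =
      hm , hm∈c , λ g∈T₀ ex →
        minimal _ (subst (SpanningTree M) (exchange-swap g∈T₀ c∉T₀) ex)
                  (λ g∈c → ∉T-edge c∉T₀ g∈c g∈T₀)
    ... | yes c∈T₀ | _ = ⊥-elim (c∉T₀ c∈T₀)

    -- The minimal half-edge of each of g and c would precede that of the other.
    no-active-exchange : ∀ {g c} → g ∈ T₀ → g ∉ S → c ∉ T₀ → c ∈ S → ¬ Exchangeable g c
    no-active-exchange g∈T₀ g∉S c∉T₀ c∈S ex
      with hg , hg∈g , g-minimal ← internal-minimum g∈T₀ g∉S
         | hc , hc∈c , c-minimal ← external-minimum c∉T₀ c∈S =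
      ≺-asym (g-minimal (∉T-edge c∉T₀ hc∈c) (Exchangeable-edge (h∈edge _) hc∈c ex))
             (c-minimal (edge⊆ closed g∈T₀ hg∈g) (Exchangeable-edge hg∈g (h∈edge _) ex))

    closedS : Closed M S
    closedS = proj₁ interval

    -- The edges met by the first k steps of the tour: the set F after k iterations of Δ.
    Visited : ℕ → Fin n → Set
    Visited k x = time x < k ⊎ time (α x) < k

    module FirstVisit {k} (k<n : k < n) {F : Subset n}
                      (F⇒visited : ∀ {x} → x ∈ F → Visited k x)
                      (visited⇒F : ∀ {x} → Visited k x → x ∈ F)
                      (τk∉F : τ k ∉ F) where

      h : Fin n
      h = τ k

      edge-h-unvisited : ∀ {x} → x ∈ edge h → k ≤ time x
      edge-h-unvisited x∈h with ∈-edge⁻ x∈h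
      ... | inj₁ refl = ≤-reflexive (sym (time-τ k<n))
      ... | inj₂ refl = ≮⇒≥ (τk∉F ∘ visited⇒F ∘ inj₂)

      edge-h-∉F : ∀ {x} → x ∈ edge h → x ∉ F
      edge-h-∉F x∈h x∈F with F⇒visited x∈F
      ... | inj₁ x<k  = <⇒≱ x<k (edge-h-unvisited x∈h)
      ... | inj₂ αx<k = <⇒≱ αx<k (edge-h-unvisited (edge-closed h _ x∈h))

      preceded-∉F : ∀ {x y} → x ∈ edge h → x ≺ y → x ≺ α y → y ∉ F
      preceded-∉F x∈h x≺y x≺αy y∈F with F⇒visited y∈F
      ... | inj₁ y<k  = <⇒≱ y<k (<⇒≤ (≤-<-trans (edge-h-unvisited x∈h) (≺⇒time< x≺y)))
      ... | inj₂ αy<k = <⇒≱ αy<k (<⇒≤ (≤-<-trans (edge-h-unvisited x∈h) (≺⇒time< x≺αy)))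

      preceding-∈F : ∀ {c x} → x ∈ edge c → x ≺ h → c ∈ F
      preceding-∈F x∈c x≺h with ∈-edge⁻ x∈c | subst (_ <_) (time-τ k<n) (≺⇒time< x≺h)
      ... | inj₁ refl | x<k = visited⇒F (inj₁ x<k)
      ... | inj₂ refl | x<k = visited⇒F (inj₂ x<k)

      internal∈S⇒no-cycle : h ∈ T₀ → h ∈ S →
                            ¬ (∃ λ C → IsCycle M C × C ⊆ S ∩ ∁ F × h ∈ C)
      internal∈S⇒no-cycle h∈T₀ h∈S (C , cycle , C⊆ , h∈C)
        with c , c∈C , c∉h , crosses ← Cut.cycle-crossing h∈T₀ cycle h∈C =
        x∈∁p⇒x∉p (p∩q⊆q S _ (C⊆ c∈C)) c∈F
        where
        c∉T₀ : c ∉ T₀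
        c∉T₀ c∈T₀ = c∉h (Cut.crossing-∈-edge h∈T₀ c∈T₀ crosses)
        c∈F : c ∈ F
        c∈F with hm , hm∈c , minimal ← external-minimum c∉T₀ (p∩q⊆p S _ (C⊆ c∈C)) =
          preceding-∈F hm∈c (minimal h∈T₀ (exchange h∈T₀ crosses))

      internal∉S⇒cocycle : h ∈ T₀ → h ∉ S →
                           ∃ λ D → IsCocycle M D × D ⊆ ∁ S ∩ ∁ F × h ∈ D
      internal∉S⇒cocycle h∈T₀ h∉S = cocycle , isCocycle , D⊆ , g∈cocycle
        where
        open Cut h∈T₀
        D⊆ : cocycle ⊆ ∁ S ∩ ∁ F
        D⊆ {x} x∈D with x ∈? edge h
        ... | yes x∈h = x∈p∩q⁺ ( x∉p⇒x∈∁p (λ x∈S → h∉S (edge⊆ closedS x∈S (∈-edge-sym x∈h)))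
                               , x∉p⇒x∈∁p (edge-h-∉F x∈h))
        ... | no  x∉h = x∈p∩q⁺ ( x∉p⇒x∈∁p (λ x∈S → no-active-exchange h∈T₀ h∉S x∉T₀ x∈S ex)
                               , x∉p⇒x∈∁p x∉F)
          where
          crosses : Crosses x
          crosses = ∈-subset⁻ Crosses? x∈D
          x∉T₀ : x ∉ T₀
          x∉T₀ x∈T₀ = x∉h (crossing-∈-edge x∈T₀ crosses)
          ex : Exchangeable h x
          ex = exchange h∈T₀ crosses
          x∉F : x ∉ F
          x∉F with hm , hm∈h , minimal ← internal-minimum h∈T₀ h∉S =
            preceded-∉F hm∈h (minimal x∉T₀ ex)
                             (minimal (∉T-edge x∉T₀ (αh∈edge x))
                                      (Exchangeable-edge (h∈edge h) (αh∈edge x) ex))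

      external∈S⇒cycle : h ∉ T₀ → h ∈ S →
                         ∃ λ C → IsCycle M C × C ⊆ S ∩ ∁ F × h ∈ C
      external∈S⇒cycle h∉T₀ h∈S = C , isCycle , C⊆ , h∈C
        where
        open FundamentalCycle h∉T₀
        C⊆ : C ⊆ S ∩ ∁ F
        C⊆ {x} x∈C with x ∈? edge h
        ... | yes x∈h = x∈p∩q⁺ (edge⊆ closedS h∈S x∈h , x∉p⇒x∈∁p (edge-h-∉F x∈h))
        ... | no  x∉h = x∈p∩q⁺ (x∈S , x∉p⇒x∈∁p x∉F)
          where
          x∈T₀ : x ∈ T₀
          x∈T₀ = C∖h⊆T (x∈p∩q⁺ (x∈C , x∉p⇒x∈∁p x∉h))
          ex : Exchangeable x h
          ex = exchange x∈T₀ (crosses x∈C x∈T₀)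
          x∈S : x ∈ S
          x∈S with x ∈? S
          ... | yes x∈S = x∈S
          ... | no  x∉S = ⊥-elim (no-active-exchange x∈T₀ x∉S h∉T₀ h∈S ex)
          x∉F : x ∉ F
          x∉F with hm , hm∈h , minimal ← external-minimum h∉T₀ h∈S =
            preceded-∉F hm∈h (minimal x∈T₀ ex)
                             (minimal (closed x x∈T₀) (Exchangeable-edge (αh∈edge x) (h∈edge h) ex))

      external∉S⇒no-cocycle : h ∉ T₀ → h ∉ S →
                              ¬ (∃ λ D → IsCocycle M D × D ⊆ ∁ S ∩ ∁ F × h ∈ D)
      external∉S⇒no-cocycle h∉T₀ h∉S (D , cocycle , D⊆ , h∈D)
        with g , g∈C , g∈T₀ , g∈D ← FundamentalCycle.meets-cocycle h∉T₀ cocycle h∈D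
        with hm , hm∈g , minimal ← internal-minimum g∈T₀ (x∈∁p⇒x∉p (p∩q⊆p (∁ S) _ (D⊆ g∈D))) =
        x∈∁p⇒x∉p (p∩q⊆q (∁ S) _ (D⊆ g∈D))
                 (preceding-∈F hm∈g (minimal h∉T₀ (exchange g∈T₀ g-crosses)))
        where
        g-crosses : Cut.Crosses g∈T₀ h
        g-crosses = FundamentalCycle.crosses h∉T₀ g∈C g∈T₀

      ∈T₀⇒addCond : h ∈ T₀ → AddCond M S F h
      ∈T₀⇒addCond h∈T₀ with h ∈? S
      ... | yes h∈S = inj₁ (h∈S , internal∈S⇒no-cycle h∈T₀ h∈S)
      ... | no  h∉S = inj₂ (h∉S , internal∉S⇒cocycle h∈T₀ h∉S)

      ∉T₀⇒¬addCond : h ∉ T₀ → ¬ AddCond M S F h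
      ∉T₀⇒¬addCond h∉T₀ (inj₁ (h∈S , no-cycle)) = no-cycle (external∈S⇒cycle h∉T₀ h∈S)
      ∉T₀⇒¬addCond h∉T₀ (inj₂ (h∉S , cocycle))  = external∉S⇒no-cocycle h∉T₀ h∉S cocycle

    visited-α : ∀ {k x} → Visited k x → Visited k (α x)
    visited-α {x = x} (inj₁ x<k)  = inj₂ (subst (λ y → time y < _) (sym (α-inv x)) x<k)
    visited-α         (inj₂ αx<k) = inj₁ αx<k

    visited-weaken : ∀ {k x} → Visited k x → Visited (suc k) x
    visited-weaken = Sum.map m<n⇒m<1+n m<n⇒m<1+n

    time≡⇒∈edge : ∀ {k x} → time x ≡ k → x ∈ edge (τ k)
    time≡⇒∈edge {k} {x} refl = subst (_∈ edge (τ k)) (τ-time x) (h∈edge (τ k))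

    visited-suc⁻ : ∀ {k x} → Visited (suc k) x → Visited k x ⊎ x ∈ edge (τ k)
    visited-suc⁻ {k} {x} (inj₁ x<1+k) with m<1+n⇒m<n∨m≡n x<1+k
    ... | inj₁ x<k = inj₁ (inj₁ x<k)
    ... | inj₂ x≡k = inj₂ (time≡⇒∈edge x≡k)
    visited-suc⁻ {k} {x} (inj₂ αx<1+k) with m<1+n⇒m<n∨m≡n αx<1+k
    ... | inj₁ αx<k = inj₁ (inj₂ αx<k)
    ... | inj₂ αx≡k =
      inj₂ (subst (_∈ edge (τ k)) (α-inv x) (edge-closed (τ k) _ (time≡⇒∈edge αx≡k)))

    visited-now : ∀ {k x} → k < n → x ∈ edge (τ k) → Visited (suc k) x
    visited-now {k} k<n x∈ with ∈-edge⁻ x∈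
    ... | inj₁ refl = inj₁ (≤-reflexive (cong suc (time-τ k<n)))
    ... | inj₂ refl = inj₂ (≤-reflexive (cong suc (trans (cong time (α-inv (τ k))) (time-τ k<n))))

    record Invariant (k : ℕ) (s : State M) : Set where
      field
        at-τ      : State.cur s ≡ τ k
        F⇒visited : ∀ {x} → x ∈ State.Fc s → Visited k x
        visited⇒F : ∀ {x} → Visited k x → x ∈ State.Fc s
        T⊆T₀      : State.Tc s ⊆ T₀
        T⊆F       : State.Tc s ⊆ State.Fc s
        T₀∩F⊆T    : ∀ {x} → x ∈ T₀ → x ∈ State.Fc s → x ∈ State.Tc s

    open Invariant

    initial-invariant : Invariant 0 (initial M)
    initial-invariant = record
      { at-τ      = refl
      ; F⇒visited = ⊥-elim ∘ ∉⊥
      ; visited⇒F = λ where (inj₁ ()) ; (inj₂ ())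
      ; T⊆T₀      = ⊥-elim ∘ ∉⊥
      ; T⊆F       = id
      ; T₀∩F⊆T    = λ _ → id
      }

    final-tree : ∀ {s} → Invariant n s → State.Tc s ≡ T₀
    final-tree inv =
      ⊆-antisym (T⊆T₀ inv) (λ x∈T₀ → T₀∩F⊆T inv x∈T₀ (visited⇒F inv (inj₁ (time<n _))))

    module _ {k} (k<n : k < n) {T F : Subset n} (inv : Invariant k ⟨ τ k , T , F ⟩) where

      F∪edge⇒visited : ∀ {x} → x ∈ F ∪ edge (τ k) → Visited (suc k) x
      F∪edge⇒visited x∈ =
        Sum.[ visited-weaken ∘ F⇒visited inv , visited-now k<n ] (x∈p∪q⁻ F _ x∈)

      visited⇒F∪edge : ∀ {x} → Visited (suc k) x → x ∈ F ∪ edge (τ k)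
      visited⇒F∪edge visited =
        Sum.[ p⊆p∪q (edge (τ k)) ∘ visited⇒F inv , q⊆p∪q F (edge (τ k)) ] (visited-suc⁻ visited)

      advance-visited : τ k ∈ F → Invariant (suc k) ⟨ next M T (τ k) , T , F ⟩
      advance-visited τk∈F = record
        { at-τ      = motion-cong (T⊆T₀ inv) (λ τk∈T₀ → T₀∩F⊆T inv τk∈T₀ τk∈F)
        ; F⇒visited = visited-weaken ∘ F⇒visited inv
        ; visited⇒F = λ visited → Sum.[ visited⇒F inv , edge⊆ F-closed τk∈F ] (visited-suc⁻ visited)
        ; T⊆T₀      = T⊆T₀ inv
        ; T⊆F       = T⊆F inv
        ; T₀∩F⊆T    = T₀∩F⊆T inv
        }
        where
        F-closed : Closed M F
        F-closed x x∈F = visited⇒F inv (visited-α (F⇒visited inv x∈F))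

      advance-added : τ k ∈ T₀ →
        Invariant (suc k) ⟨ next M (T ∪ edge (τ k)) (τ k) , T ∪ edge (τ k) , F ∪ edge (τ k) ⟩
      advance-added τk∈T₀ = record
        { at-τ      = motion-cong (λ _ → τk∈T₀) (λ _ → q⊆p∪q T _ (h∈edge (τ k)))
        ; F⇒visited = F∪edge⇒visited
        ; visited⇒F = visited⇒F∪edge
        ; T⊆T₀      = Sum.[ T⊆T₀ inv , edge⊆ closed τk∈T₀ ] ∘ x∈p∪q⁻ T _
        ; T⊆F       = Sum.[ p⊆p∪q _ ∘ T⊆F inv , q⊆p∪q F _ ] ∘ x∈p∪q⁻ T _
        ; T₀∩F⊆T    = λ x∈T₀ → Sum.[ p⊆p∪q _ ∘ T₀∩F⊆T inv x∈T₀ , q⊆p∪q T _ ] ∘ x∈p∪q⁻ F _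
        }

      advance-skipped : τ k ∉ F → τ k ∉ T₀ →
        Invariant (suc k) ⟨ next M T (τ k) , T , F ∪ edge (τ k) ⟩
      advance-skipped τk∉F τk∉T₀ = record
        { at-τ      = motion-cong (⊥-elim ∘ τk∉F ∘ T⊆F inv) (⊥-elim ∘ τk∉T₀)
        ; F⇒visited = F∪edge⇒visited
        ; visited⇒F = visited⇒F∪edge
        ; T⊆T₀      = T⊆T₀ inv
        ; T⊆F       = p⊆p∪q _ ∘ T⊆F inv
        ; T₀∩F⊆T    = λ x∈T₀ →
            Sum.[ T₀∩F⊆T inv x∈T₀ , (λ x∈τk → ⊥-elim (∉T-edge τk∉T₀ x∈τk x∈T₀)) ] ∘ x∈p∪q⁻ F _
        }

    advance : ∀ {k s} → k < n → Invariant k s → ∃ λ s′ → Step M S s s′ × Invariant (suc k) s′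
    advance {k} {⟨ _ , T , F ⟩} k<n inv with refl ← at-τ inv with τ k ∈? F | τ k ∈? T₀
    ... | yes τk∈F | _ = _ , inF τk∈F , advance-visited k<n inv τk∈F
    ... | no  τk∉F | yes τk∈T₀ =
      _ , add τk∉F (∈T₀⇒addCond τk∈T₀) , advance-added k<n inv τk∈T₀
      where open FirstVisit k<n (F⇒visited inv) (visited⇒F inv) τk∉F
    ... | no  τk∉F | no  τk∉T₀ =
      _ , noAdd τk∉F (∉T₀⇒¬addCond τk∉T₀) , advance-skipped k<n inv τk∉F τk∉T₀
      where open FirstVisit k<n (F⇒visited inv) (visited⇒F inv) τk∉F

    finish : ∀ {k s s′} → suc k ≡ n → Step M S s s′ → Invariant (suc k) s′ → Run M S s T₀
    finish {s = s} {s′} 1+k≡n step inv′ =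
      subst (Run M S s) (final-tree inv-n) (stop step (trans (at-τ inv-n) τ-n))
      where
      inv-n : Invariant n s′
      inv-n = subst (λ j → Invariant j s′) 1+k≡n inv′

    continue : ∀ {k s s′} → suc k < n → Step M S s s′ → Invariant (suc k) s′ →
               Run M S s′ T₀ → Run M S s T₀
    continue 1+k<n step inv′ =
      go step (λ at-root → τ-injective z<s 1+k<n (sym (trans (sym (at-τ inv′)) at-root)))

    remaining⇒< : ∀ d {k} → d + suc k ≡ n → k < n
    remaining⇒< d {k} d+1+k≡n = subst (k <_) d+1+k≡n (m≤n+m (suc k) d)

    -- d counts the iterations left after the current one.
    run-from : ∀ d {k s} → d + suc k ≡ n → Invariant k s → Run M S s T₀
    run-from zero 1+k≡n inv with _ , step , inv′ ← advance (remaining⇒< zero 1+k≡n) inv =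
      finish 1+k≡n step inv′
    run-from (suc d) {k} d+2+k≡n inv
      with _ , step , inv′ ← advance (remaining⇒< (suc d) d+2+k≡n) inv =
      continue (remaining⇒< d d+2+k≡n′) step inv′ (run-from d d+2+k≡n′ inv′)
      where
      d+2+k≡n′ : d + suc (suc k) ≡ n
      d+2+k≡n′ = trans (+-suc d (suc k)) d+2+k≡n

  step-deterministic : ∀ {S s s₁ s₂} → Step M S s s₁ → Step M S s s₂ → s₁ ≡ s₂
  step-deterministic (inF _)      (inF _)       = refl
  step-deterministic (inF p)      (add ¬p _)    = ⊥-elim (¬p p)
  step-deterministic (inF p)      (noAdd ¬p _)  = ⊥-elim (¬p p)
  step-deterministic (add ¬p _)   (inF p)       = ⊥-elim (¬p p)
  step-deterministic (add _ _)    (add _ _)     = refl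
  step-deterministic (add _ c)    (noAdd _ ¬c)  = ⊥-elim (¬c c)
  step-deterministic (noAdd ¬p _) (inF p)       = ⊥-elim (¬p p)
  step-deterministic (noAdd _ ¬c) (add _ c)     = ⊥-elim (¬c c)
  step-deterministic (noAdd _ _)  (noAdd _ _)   = refl

  run-deterministic : ∀ {S s R₁ R₂} → Run M S s R₁ → Run M S s R₂ → R₁ ≡ R₂
  run-deterministic (stop step₁ _) (stop step₂ _) = cong State.Tc (step-deterministic step₁ step₂)
  run-deterministic (stop step₁ at-root) (go step₂ not-root _) =
    ⊥-elim (not-root (trans (cong State.cur (step-deterministic step₂ step₁)) at-root))
  run-deterministic (go step₁ not-root _) (stop step₂ at-root) =
    ⊥-elim (not-root (trans (cong State.cur (step-deterministic step₁ step₂)) at-root))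
  run-deterministic {S} (go step₁ _ run₁) (go step₂ _ run₂) =
    run-deterministic run₁ (subst (λ s → Run M S s _) (step-deterministic step₂ step₁) run₂)

proposition15 : (M : RootedMap) (T₀ S : EdgeSet M) →
    SpanningTree M T₀ → InTreeInterval M T₀ S →
    Run M S (initial M) T₀ × (∀ R → Run M S (initial M) R → R ≡ T₀)
proposition15 M T₀ S tree interval = run , λ R run′ → run-deterministic M run′ run
  where
  open Interval M tree interval
  run : Run M S (initial M) T₀
  run with d , 1+d≡n , _ ← exact-period = run-from d (trans (+-comm d 1) 1+d≡n) initial-invariant
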